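{- Let $m$ be an odd square-free positive integer and $p$ a prime with $\gcd(p,m)=1$; put $r=\mathrm{rem}(p,m)$, $q=\mathrm{quo}(p,m)$. Write $G(x)=\Psi_m(x)\sum_{u\geq0}x^{um}=\sum_{t\geq0}e_t x^t\in\mathbb{Z}[[x]]$, and for $0\leq i\leq\varphi(m)-1$, $0\le j\le q$ define $g_{m,p,i,j}=\sum_{k=0}^{l}e_{ip+mj+k}x^k$, where $l=m-1$ if $j<q$ and $l=r-1$ if $j=q$. Then for all $0\leq i\leq\varphi(m)-1$: (1) $g_{m,p,i,0}=\cdots=g_{m,p,i,q-1}=\mathcal{R}_{ir}\Psi_m$; (2) $g_{m,p,i,q}=\mathcal{T}_r\,g_{m,p,i,0}$.
   Context: $\Phi_n$ is the $n$-th cyclotomic polynomial, $\varphi$ is Euler's totient, and $\Psi_m(x)=(x^m-1)/\Phi_m(x)$. For integers $a,b$ with $b>0$, $\mathrm{rem}(a,b)$ denotes the non-negative remainder and $\mathrm{quo}(a,b)$ the quotient; for polynomials, $\mathrm{rem}(f,g)$ is the polynomial remainder. For a polynomial $f$ and integer $s$: $\mathcal{T}_s f=\mathrm{rem}(f,x^s)$ ($s\ge0$) and $\mathcal{R}_s f=\mathrm{rem}\left(x^{m-\mathrm{rem}(s,m)}f,\;x^m-1\right)$. -}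

module Defs where

open import Data.Nat as ℕ using (ℕ; zero; suc; _∸_; NonZero)
open import Data.Nat.DivMod using (_%_)
open import Data.Nat.Divisibility using (_∣?_)
open import Data.Nat.Coprimality using (coprime?)
open import Data.Integer as ℤ using (ℤ; +_; -[1+_])
open import Data.List using (List; []; _∷_; map; foldr; filter; upTo; length; replicate; take; _++_)
open import Relation.Nullary using (Dec; yes; no)
open import Relation.Binary.PropositionalEquality using (_≡_)

-- Polynomials in ℤ[x] as coefficient lists, lowest degree first.
Poly : Set
Poly = List ℤ

coeff : Poly → ℕ → ℤ
coeff []      n       = + 0
coeff (a ∷ f) zero    = a
coeff (a ∷ f) (suc n) = coeff f n

-- equality of polynomials (insensitive to trailing zeros)
infix 4 _≈ₚ_
_≈ₚ_ : Poly → Poly → Set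
f ≈ₚ g = ∀ n → coeff f n ≡ coeff g n

infixl 6 _+ₚ_
_+ₚ_ : Poly → Poly → Poly
[]      +ₚ g       = g
(a ∷ f) +ₚ []      = a ∷ f
(a ∷ f) +ₚ (b ∷ g) = (a ℤ.+ b) ∷ (f +ₚ g)

infixl 7 _*ₚ_
_*ₚ_ : Poly → Poly → Poly
[]      *ₚ g = []
(a ∷ f) *ₚ g = map (a ℤ.*_) g +ₚ (+ 0 ∷ (f *ₚ g))

oneₚ : Poly
oneₚ = + 1 ∷ []

prodₚ : List Poly → Poly
prodₚ = foldr _*ₚ_ oneₚ

xPowMinusOne : ℕ → Poly
xPowMinusOne n = (replicate n (+ 0) ++ (+ 1 ∷ [])) +ₚ (-[1+ 0 ] ∷ [])

divisors : ℕ → List ℕ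
divisors n = filter (_∣? n) (map suc (upTo n))

-- Φ is the family of cyclotomic polynomials: x^n - 1 = ∏_{d ∣ n} Φ_d for all n ≥ 1
-- (this determines Φ uniquely, already in ℤ[[x]])
IsCyclotomicFamily : (ℕ → Poly) → Set
IsCyclotomicFamily Φ = ∀ n → NonZero n → xPowMinusOne n ≈ₚ prodₚ (map Φ (divisors n))

IsPsi : (ℕ → Poly) → ℕ → Poly → Set
IsPsi Φ m Ψ = Ψ *ₚ Φ m ≈ₚ xPowMinusOne m

sumℤ : List ℤ → ℤ
sumℤ = foldr ℤ._+_ (+ 0)

indicator : {A : Set} → Dec A → ℤ
indicator (yes _) = + 1
indicator (no _)  = + 0

totient : ℕ → ℕ
totient n = length (filter (λ k → coprime? k n) (upTo n))

-- e_t : coefficients of G(x) = Ψ(x) · Σ_{u≥0} x^{um}  (Cauchy product)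
eCoeff : ℕ → Poly → ℕ → ℤ
eCoeff m Ψ t = sumℤ (map (λ k → coeff Ψ k ℤ.* indicator (m ∣? (t ∸ k))) (upTo (suc t)))

-- rem(f, x^m - 1): the coefficient of x^k (k < m) is Σ_{t ≡ k mod m} f_t
remXmMinusOne : (m : ℕ) → .{{NonZero m}} → Poly → Poly
remXmMinusOne m f =
  map (λ k → sumℤ (map (λ t → indicator ((t % m) ℕ.≟ k) ℤ.* coeff f t) (upTo (length f)))) (upTo m)

shiftₚ : ℕ → Poly → Poly
shiftₚ k f = replicate k (+ 0) ++ f

Rop : (m : ℕ) → .{{NonZero m}} → ℕ → Poly → Poly
Rop m s f = remXmMinusOne m (shiftₚ (m ∸ (s % m)) f)

Top : ℕ → Poly → Poly
Top s f = take s f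

gPoly : (m : ℕ) → Poly → (p i j q r : ℕ) → Poly
gPoly m Ψ p i j q r = map (λ k → eCoeff m Ψ (i ℕ.* p ℕ.+ m ℕ.* j ℕ.+ k)) (upTo len)
  where
  len : ℕ
  len with j ℕ.<? q
  ... | yes _ = m
  ... | no _  = r

-- From x^n - 1 = ∏_{d ∣ n} Φ_d, the degrees of the Φ_n satisfy
-- Σ_{d ∣ n} deg Φ_d = n, which determines them by strong induction; Gauss's identity
-- Σ_{d ∣ n} φ(d) = n (count k < n according to n / gcd(k, n)) then gives deg Φ_n = φ(n).
-- In particular deg Φ_m ≥ 1, so Ψ_m = (x^m - 1)/Φ_m has degree below m and the
-- coefficients of G = Ψ_m Σ_u x^(um) are m-periodic: e_t = [x^(t mod m)] Ψ_m.
-- A block g_{m,p,i,j} therefore reads Ψ_m cyclically from index ip ≡ ir (mod m),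
-- which is 𝓡_{ir} Ψ_m, and the last block is the first one cut after r terms.

module Submission where

open import Defs
open import Algebra.Bundles using (CommutativeMonoid)
open import Data.Nat as ℕ using (ℕ; zero; suc; _+_; _*_; _∸_; _≤_; _<_; z≤n; s≤s; z<s; s<s; NonZero)
open import Data.Nat.Properties
  using ( +-0-commutativeMonoid; +-comm; +-identityʳ; +-cancelˡ-≡; +-cancelʳ-≡; +-monoʳ-≤
        ; *-comm; *-identityʳ; *-zeroʳ; *-distribˡ-+; *-cancelˡ-≡; *-cancelʳ-≡
        ; ≤-refl; ≤-reflexive; ≤-trans; ≤-pred; <⇒≤; <⇒≱; ≮⇒≥; ≰⇒>; ≤∧≢⇒<; <-cmp; <-irrefl
        ; m≤m+n; m≤n+m; m∸n+n≡m; m+n∸m≡n; m+[n∸m]≡n; suc-injective; _≟_; _<?_; _≤?_ )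
open import Data.Nat.DivMod
  using ( _%_; _/_; m≡m%n+[m/n]*n; %-distribˡ-+; %-remove-+ˡ; m%n%n≡m%n
        ; [m+n]%n≡m%n; [m+kn]%n≡m%n; m%n<n; m%n≤n; m%n≤m; m<n⇒m%n≡m )
open import Data.Nat.Divisibility using (_∣_; _∣?_; divides; ∣⇒≤; ∣-refl; ∣m+n∣m⇒∣n)
open import Data.Nat.GCD using (gcd; gcd[m,n]∣m; gcd[m,n]∣n; c*gcd[m,n]≡gcd[cm,cn])
open import Data.Nat.Coprimality using (Coprime; coprime?; coprime⇒gcd≡1; gcd≡1⇒coprime; 1-coprimeTo)
open import Data.Nat.Primality using (Prime)
open import Data.Nat.Induction using (<-rec)
open import Data.Nat.ListAction using (sum)
open import Data.Nat.Solver using (module +-*-Solver)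
open import Data.Integer as ℤ using (ℤ; +_; -[1+_])
open import Data.Integer.Properties as ℤ using ()
open import Data.List using ([]; _∷_; map; foldr; filter; upTo; applyUpTo; length; replicate; take)
open import Data.List.Properties using (map-∘; map-upTo; length-++; length-replicate)
open import Data.Product using (_×_; _,_; ∃)
open import Data.Sum using (_⊎_; inj₁; inj₂)
open import Function using (_∘_; _$_; flip)
open import Relation.Nullary using (Dec; yes; no; ¬_; contradiction)
open import Relation.Unary using (Pred; Decidable)
open import Relation.Binary.Definitions using (tri<; tri≈; tri>)
open import Relation.Binary.PropositionalEquality

open +-*-Solver using (solve; _:=_; _:+_; _:*_)

applyUpTo-cong : ∀ {a} {A : Set a} n {f g : ℕ → A} → (∀ {k} → k < n → f k ≡ g k) → applyUpTo f n ≡ applyUpTo g n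
applyUpTo-cong zero    f≡g = refl
applyUpTo-cong (suc n) f≡g = cong₂ _∷_ (f≡g z<s) (applyUpTo-cong n (f≡g ∘ s<s))

take-applyUpTo : ∀ {a} {A : Set a} (f : ℕ → A) {r n} → r ≤ n → take r (applyUpTo f n) ≡ applyUpTo f r
take-applyUpTo f {zero}  _         = refl
take-applyUpTo f {suc r} (s≤s r≤n) = cong (f 0 ∷_) (take-applyUpTo (f ∘ suc) r≤n)

≡⇒≈ₚ : ∀ {f g} → f ≡ g → f ≈ₚ g
≡⇒≈ₚ refl _ = refl

coeff-beyond : ∀ (f : Poly) {n} → length f ≤ n → coeff f n ≡ + 0
coeff-beyond []      _         = refl
coeff-beyond (a ∷ f) (s≤s len) = coeff-beyond f len

coeff-shiftₚ-< : ∀ s (f : Poly) {t} → t < s → coeff (shiftₚ s f) t ≡ + 0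
coeff-shiftₚ-< (suc s) f {zero}  _         = refl
coeff-shiftₚ-< (suc s) f {suc t} (s≤s t<s) = coeff-shiftₚ-< s f t<s

coeff-shiftₚ : ∀ s (f : Poly) u → coeff (shiftₚ s f) (s + u) ≡ coeff f u
coeff-shiftₚ zero    f u = refl
coeff-shiftₚ (suc s) f u = coeff-shiftₚ s f u

length-shiftₚ : ∀ s (f : Poly) → length (shiftₚ s f) ≡ s + length f
length-shiftₚ s f = trans (length-++ (replicate s (+ 0))) (cong (_+ length f) (length-replicate s))

coeff-+ₚ : ∀ (f g : Poly) n → coeff (f +ₚ g) n ≡ coeff f n ℤ.+ coeff g n
coeff-+ₚ []      g       n       = sym (ℤ.+-identityˡ _)
coeff-+ₚ (a ∷ f) []      n       = sym (ℤ.+-identityʳ _)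
coeff-+ₚ (a ∷ f) (b ∷ g) zero    = refl
coeff-+ₚ (a ∷ f) (b ∷ g) (suc n) = coeff-+ₚ f g n

coeff-scale : ∀ a (g : Poly) n → coeff (map (a ℤ.*_) g) n ≡ a ℤ.* coeff g n
coeff-scale a []      n       = sym (ℤ.*-zeroʳ a)
coeff-scale a (b ∷ g) zero    = refl
coeff-scale a (b ∷ g) (suc n) = coeff-scale a g n

coeff-∷-*ₚ-zero : ∀ a f g → coeff ((a ∷ f) *ₚ g) 0 ≡ a ℤ.* coeff g 0
coeff-∷-*ₚ-zero a f g = trans (coeff-+ₚ (map (a ℤ.*_) g) _ 0)
  (trans (ℤ.+-identityʳ _) (coeff-scale a g 0))

coeff-∷-*ₚ-suc : ∀ a f g n → coeff ((a ∷ f) *ₚ g) (suc n) ≡ a ℤ.* coeff g (suc n) ℤ.+ coeff (f *ₚ g) n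
coeff-∷-*ₚ-suc a f g n = trans (coeff-+ₚ (map (a ℤ.*_) g) _ (suc n))
  (cong (ℤ._+ coeff (f *ₚ g) n) (coeff-scale a g (suc n)))

infix 4 _HasDegree_
record _HasDegree_ (f : Poly) (d : ℕ) : Set where
  constructor mkHasDegree
  field
    leading≢0      : coeff f d ≢ + 0
    vanishes-above : ∀ {n} → d < n → coeff f n ≡ + 0

open _HasDegree_

HasDegree-unique : ∀ {f a b} → f HasDegree a → f HasDegree b → a ≡ b
HasDegree-unique {a = a} {b} (mkHasDegree fa≢0 above-a) (mkHasDegree fb≢0 above-b) with <-cmp a b
... | tri< a<b _ _ = contradiction (above-a a<b) fb≢0
... | tri≈ _ a≡b _ = a≡b
... | tri> _ _ b<a = contradiction (above-b b<a) fa≢0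

HasDegree-resp-≈ₚ : ∀ {f g d} → f ≈ₚ g → f HasDegree d → g HasDegree d
HasDegree-resp-≈ₚ {d = d} f≈g (mkHasDegree fd≢0 above) =
  mkHasDegree (λ gd≡0 → fd≢0 (trans (f≈g d) gd≡0)) (λ {n} d<n → trans (sym (f≈g n)) (above d<n))

zero⊎HasDegree : ∀ f → f ≈ₚ [] ⊎ ∃ (f HasDegree_)
zero⊎HasDegree [] = inj₁ λ _ → refl
zero⊎HasDegree (a ∷ f) with zero⊎HasDegree f
... | inj₂ (d , mkHasDegree fd≢0 above) = inj₂ (suc d , mkHasDegree fd≢0 λ { {suc n} (s≤s d<n) → above d<n })
... | inj₁ f≈0 with a ℤ.≟ + 0
...   | yes a≡0 = inj₁ λ { zero → a≡0 ; (suc n) → f≈0 n }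
...   | no a≢0  = inj₂ (0 , mkHasDegree a≢0 λ { {suc n} _ → f≈0 n })

-- the zero polynomial gets degree 0
degree : Poly → ℕ
degree f with zero⊎HasDegree f
... | inj₁ _       = 0
... | inj₂ (d , _) = d

HasDegree-degree : ∀ f → ¬ f ≈ₚ [] → f HasDegree degree f
HasDegree-degree f f≉0 with zero⊎HasDegree f
... | inj₁ f≈0       = contradiction f≈0 f≉0
... | inj₂ (_ , f-d) = f-d

zero-*ₚ : ∀ f g → f ≈ₚ [] → f *ₚ g ≈ₚ []
zero-*ₚ []      g f≈0 n       = refl
zero-*ₚ (a ∷ f) g f≈0 zero    = begin
  coeff ((a ∷ f) *ₚ g) 0 ≡⟨ coeff-∷-*ₚ-zero a f g ⟩
  a ℤ.* coeff g 0        ≡⟨ cong (ℤ._* coeff g 0) (f≈0 0) ⟩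
  + 0                    ∎
  where open ≡-Reasoning
zero-*ₚ (a ∷ f) g f≈0 (suc n) = begin
  coeff ((a ∷ f) *ₚ g) (suc n)                 ≡⟨ coeff-∷-*ₚ-suc a f g n ⟩
  a ℤ.* coeff g (suc n) ℤ.+ coeff (f *ₚ g) n   ≡⟨ cong₂ (λ x y → x ℤ.* coeff g (suc n) ℤ.+ y) (f≈0 0) (zero-*ₚ f g (f≈0 ∘ suc) n) ⟩
  + 0                                          ∎
  where open ≡-Reasoning

*ₚ-zero : ∀ f g → g ≈ₚ [] → f *ₚ g ≈ₚ []
*ₚ-zero []      g g≈0 n       = refl
*ₚ-zero (a ∷ f) g g≈0 zero    = begin
  coeff ((a ∷ f) *ₚ g) 0 ≡⟨ coeff-∷-*ₚ-zero a f g ⟩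
  a ℤ.* coeff g 0        ≡⟨ cong (a ℤ.*_) (g≈0 0) ⟩
  a ℤ.* + 0              ≡⟨ ℤ.*-zeroʳ a ⟩
  + 0                    ∎
  where open ≡-Reasoning
*ₚ-zero (a ∷ f) g g≈0 (suc n) = begin
  coeff ((a ∷ f) *ₚ g) (suc n)                 ≡⟨ coeff-∷-*ₚ-suc a f g n ⟩
  a ℤ.* coeff g (suc n) ℤ.+ coeff (f *ₚ g) n   ≡⟨ cong₂ (λ x y → a ℤ.* x ℤ.+ y) (g≈0 (suc n)) (*ₚ-zero f g g≈0 n) ⟩
  a ℤ.* + 0 ℤ.+ + 0                            ≡⟨ cong (ℤ._+ + 0) (ℤ.*-zeroʳ a) ⟩
  + 0                                          ∎
  where open ≡-Reasoning

HasDegree-*ₚ : ∀ f g {a b} → f HasDegree a → g HasDegree b → f *ₚ g HasDegree a + b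
HasDegree-*ₚ []      g (mkHasDegree 0≢0 _) _ = contradiction refl 0≢0
HasDegree-*ₚ (c ∷ f) g {zero} {b} (mkHasDegree c≢0 above) (mkHasDegree gb≢0 above-b) = mkHasDegree top≢0 vanish
  where
  f≈0 : f ≈ₚ []
  f≈0 n = above (s≤s z≤n)
  coeff-≡-scaled : ∀ n → coeff ((c ∷ f) *ₚ g) n ≡ c ℤ.* coeff g n
  coeff-≡-scaled zero    = coeff-∷-*ₚ-zero c f g
  coeff-≡-scaled (suc n) = trans (coeff-∷-*ₚ-suc c f g n)
    (trans (cong (ℤ._+_ (c ℤ.* coeff g (suc n))) (zero-*ₚ f g f≈0 n)) (ℤ.+-identityʳ _))
  top≢0 : coeff ((c ∷ f) *ₚ g) b ≢ + 0
  top≢0 cgb≡0 with ℤ.i*j≡0⇒i≡0∨j≡0 c (trans (sym (coeff-≡-scaled b)) cgb≡0)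
  ... | inj₁ c≡0  = c≢0 c≡0
  ... | inj₂ gb≡0 = gb≢0 gb≡0
  vanish : ∀ {n} → b < n → coeff ((c ∷ f) *ₚ g) n ≡ + 0
  vanish {n} b<n = trans (coeff-≡-scaled n) (trans (cong (c ℤ.*_) (above-b b<n)) (ℤ.*-zeroʳ c))
HasDegree-*ₚ (c ∷ f) g {suc a} {b} (mkHasDegree fa≢0 above) g-b@(mkHasDegree _ above-b) = mkHasDegree top≢0 vanish
  where
  f*g-deg : f *ₚ g HasDegree a + b
  f*g-deg = HasDegree-*ₚ f g (mkHasDegree fa≢0 λ a<n → above (s≤s a<n)) g-b
  coeff-≡-tail : ∀ {n} → a + b ≤ n → coeff ((c ∷ f) *ₚ g) (suc n) ≡ coeff (f *ₚ g) n
  coeff-≡-tail {n} a+b≤n = begin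
    coeff ((c ∷ f) *ₚ g) (suc n)                ≡⟨ coeff-∷-*ₚ-suc c f g n ⟩
    c ℤ.* coeff g (suc n) ℤ.+ coeff (f *ₚ g) n  ≡⟨ cong (λ x → c ℤ.* x ℤ.+ coeff (f *ₚ g) n) (above-b (s≤s (≤-trans (m≤n+m b a) a+b≤n))) ⟩
    c ℤ.* + 0 ℤ.+ coeff (f *ₚ g) n              ≡⟨ cong (ℤ._+ coeff (f *ₚ g) n) (ℤ.*-zeroʳ c) ⟩
    + 0 ℤ.+ coeff (f *ₚ g) n                    ≡⟨ ℤ.+-identityˡ _ ⟩
    coeff (f *ₚ g) n                            ∎
    where open ≡-Reasoning
  top≢0 : coeff ((c ∷ f) *ₚ g) (suc (a + b)) ≢ + 0
  top≢0 = leading≢0 f*g-deg ∘ trans (sym (coeff-≡-tail ≤-refl))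
  vanish : ∀ {n} → suc (a + b) < n → coeff ((c ∷ f) *ₚ g) n ≡ + 0
  vanish {suc n} (s≤s a+b<n) = trans (coeff-≡-tail (<⇒≤ a+b<n)) (vanishes-above f*g-deg a+b<n)

HasDegree-prodₚ : ∀ fs → ¬ prodₚ fs ≈ₚ [] → prodₚ fs HasDegree sum (map degree fs)
HasDegree-prodₚ []       _    = mkHasDegree (λ ()) λ { {suc n} _ → refl }
HasDegree-prodₚ (f ∷ fs) ∏≉0 =
  HasDegree-*ₚ f (prodₚ fs) (HasDegree-degree f f≉0) (HasDegree-prodₚ fs rest≉0)
  where
  f≉0 : ¬ f ≈ₚ []
  f≉0 = ∏≉0 ∘ zero-*ₚ f (prodₚ fs)
  rest≉0 : ¬ prodₚ fs ≈ₚ []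
  rest≉0 = ∏≉0 ∘ *ₚ-zero f (prodₚ fs)

HasDegree-xPowMinusOne : ∀ n → .{{NonZero n}} → xPowMinusOne n HasDegree n
HasDegree-xPowMinusOne n@(suc _) = mkHasDegree top≢0 vanish
  where
  top≡1 : coeff (xPowMinusOne n) n ≡ + 1
  top≡1 = begin
    coeff (xPowMinusOne n) n                     ≡⟨ coeff-+ₚ (shiftₚ n oneₚ) (-[1+ 0 ] ∷ []) n ⟩
    coeff (shiftₚ n oneₚ) n ℤ.+ + 0              ≡⟨ ℤ.+-identityʳ _ ⟩
    coeff (shiftₚ n oneₚ) n                      ≡⟨ cong (coeff (shiftₚ n oneₚ)) (sym (+-identityʳ n)) ⟩
    coeff (shiftₚ n oneₚ) (n + 0)                ≡⟨ coeff-shiftₚ n oneₚ 0 ⟩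
    + 1                                          ∎
    where open ≡-Reasoning
  top≢0 : coeff (xPowMinusOne n) n ≢ + 0
  top≢0 top≡0 with trans (sym top≡1) top≡0
  ... | ()
  vanish : ∀ {k} → n < k → coeff (xPowMinusOne n) k ≡ + 0
  vanish {suc k} n<k = begin
    coeff (xPowMinusOne n) (suc k)               ≡⟨ coeff-+ₚ (shiftₚ n oneₚ) (-[1+ 0 ] ∷ []) (suc k) ⟩
    coeff (shiftₚ n oneₚ) (suc k) ℤ.+ + 0        ≡⟨ ℤ.+-identityʳ _ ⟩
    coeff (shiftₚ n oneₚ) (suc k)                ≡⟨ coeff-beyond (shiftₚ n oneₚ) length≤ ⟩
    + 0                                          ∎
    where
    open ≡-Reasoning
    length≤ : length (shiftₚ n oneₚ) ≤ suc k
    length≤ = subst (_≤ suc k) (trans (+-comm 1 n) (sym (length-shiftₚ n oneₚ))) n<k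

module FiniteSum {c ℓ} (M : CommutativeMonoid c ℓ) where

  open CommutativeMonoid M renaming (refl to ≈-refl; sym to ≈-sym; trans to ≈-trans)
  open import Algebra.Properties.CommutativeSemigroup commutativeSemigroup using (interchange)
  open import Relation.Binary.Reasoning.Setoid (CommutativeMonoid.setoid M)

  ∑ : ℕ → (ℕ → Carrier) → Carrier
  ∑ n f = foldr _∙_ ε (applyUpTo f n)

  ∑-cong : ∀ n {f g} → (∀ {k} → k < n → f k ≈ g k) → ∑ n f ≈ ∑ n g
  ∑-cong zero    f≈g = ≈-refl
  ∑-cong (suc n) f≈g = ∙-cong (f≈g z<s) (∑-cong n (f≈g ∘ s<s))

  ∑-zero : ∀ n {f} → (∀ {k} → k < n → f k ≈ ε) → ∑ n f ≈ ε
  ∑-zero zero    f≈ε = ≈-refl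
  ∑-zero (suc n) f≈ε = ≈-trans (∙-cong (f≈ε z<s) (∑-zero n (f≈ε ∘ s<s))) (identityˡ ε)

  ∑-single : ∀ n f k₀ → (∀ {k} → k < n → k ≢ k₀ → f k ≈ ε) → (n ≤ k₀ → f k₀ ≈ ε) → ∑ n f ≈ f k₀
  ∑-single zero    f k₀       _      outside = ≈-sym (outside z≤n)
  ∑-single (suc n) f zero     others _       = begin
    f 0 ∙ ∑ n (f ∘ suc) ≈⟨ ∙-congˡ (∑-zero n (λ k<n → others (s<s k<n) λ ())) ⟩
    f 0 ∙ ε             ≈⟨ identityʳ (f 0) ⟩
    f 0                 ∎
  ∑-single (suc n) f (suc k₀) others outside = begin
    f 0 ∙ ∑ n (f ∘ suc) ≈⟨ ∙-congʳ (others z<s λ ()) ⟩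
    ε ∙ ∑ n (f ∘ suc)   ≈⟨ identityˡ _ ⟩
    ∑ n (f ∘ suc)       ≈⟨ ∑-single n (f ∘ suc) k₀ (λ k<n k≢k₀ → others (s<s k<n) (k≢k₀ ∘ suc-injective)) (outside ∘ s≤s) ⟩
    f (suc k₀)          ∎

  ∑-split : ∀ a b f → ∑ (a + b) f ≈ ∑ a f ∙ ∑ b (λ k → f (a + k))
  ∑-split zero    b f = ≈-sym (identityˡ _)
  ∑-split (suc a) b f = ≈-trans (∙-congˡ (∑-split a b (f ∘ suc))) (≈-sym (assoc _ _ _))

  ∑-distrib-∙ : ∀ n f g → ∑ n (λ k → f k ∙ g k) ≈ ∑ n f ∙ ∑ n g
  ∑-distrib-∙ zero    f g = ≈-sym (identityˡ ε)
  ∑-distrib-∙ (suc n) f g = ≈-trans (∙-congˡ (∑-distrib-∙ n (f ∘ suc) (g ∘ suc))) (interchange _ _ _ _)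

  ∑-comm : ∀ n m (h : ℕ → ℕ → Carrier) → ∑ n (λ k → ∑ m (h k)) ≈ ∑ m (λ d → ∑ n (λ k → h k d))
  ∑-comm zero    m h = ≈-sym (∑-zero m (λ _ → ≈-refl))
  ∑-comm (suc n) m h = ≈-trans (∙-congˡ (∑-comm n m (h ∘ suc))) (≈-sym (∑-distrib-∙ m (h 0) _))

  ∑-multiples : ∀ D q .{{_ : NonZero q}} f → (∀ {k} → ¬ q ∣ k → f k ≈ ε) → ∑ (D * q) f ≈ ∑ D (λ j → f (j * q))
  ∑-multiples zero    q f _        = ≈-refl
  ∑-multiples (suc D) q@(suc _) f off-multiples = begin
    ∑ (q + D * q) f                           ≈⟨ ∑-split q (D * q) f ⟩
    ∑ q f ∙ ∑ (D * q) (λ k → f (q + k))        ≈⟨ ∙-cong first-block rest ⟩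
    f 0 ∙ ∑ D (λ j → f (q + j * q))            ∎
    where
    first-block : ∑ q f ≈ f 0
    first-block = ∑-single q f 0 (λ { {zero} _ 0≢0 → contradiction refl 0≢0 ; {suc k} k<q _ → off-multiples (<⇒≱ k<q ∘ ∣⇒≤) }) (λ ())
    rest : ∑ (D * q) (λ k → f (q + k)) ≈ ∑ D (λ j → f (q + j * q))
    rest = ∑-multiples D q (λ k → f (q + k)) (λ q∤k → off-multiples (q∤k ∘ flip ∣m+n∣m⇒∣n ∣-refl))

open FiniteSum +-0-commutativeMonoid
module ℤSum = FiniteSum ℤ.+-0-commutativeMonoid

∑-*ˡ : ∀ n c f → ∑ n (λ k → c * f k) ≡ c * ∑ n f
∑-*ˡ zero    c f = sym (*-zeroʳ c)
∑-*ˡ (suc n) c f = trans (cong (_+_ (c * f 0)) (∑-*ˡ n c (f ∘ suc))) (sym (*-distribˡ-+ c (f 0) _))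

∑-const-1 : ∀ n → ∑ n (λ _ → 1) ≡ n
∑-const-1 zero    = refl
∑-const-1 (suc n) = cong suc (∑-const-1 n)

term≤∑ : ∀ n f {k} → k < n → f k ≤ ∑ n f
term≤∑ (suc n) f {zero}  _         = m≤m+n (f 0) _
term≤∑ (suc n) f {suc k} (s<s k<n) = ≤-trans (term≤∑ n (f ∘ suc) k<n) (m≤n+m _ (f 0))

∑-cancel : ∀ n f g {k₀} → ∑ n f ≡ ∑ n g → (∀ {k} → k < n → k ≢ k₀ → f k ≡ g k) → k₀ < n → f k₀ ≡ g k₀
∑-cancel (suc n) f g {zero} ∑f≡∑g agree _ =
  +-cancelʳ-≡ _ (f 0) (g 0) (trans ∑f≡∑g (cong (_+_ (g 0)) (sym (∑-cong n (λ k<n → agree (s<s k<n) λ ())))))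
∑-cancel (suc n) f g {suc k₀} ∑f≡∑g agree (s<s k₀<n) =
  ∑-cancel n (f ∘ suc) (g ∘ suc) (+-cancelˡ-≡ (f 0) _ _ (trans ∑f≡∑g (cong (_+ _) (sym (agree z<s λ ())))))
    (λ k<n k≢k₀ → agree (s<s k<n) (k≢k₀ ∘ suc-injective)) k₀<n

𝟙 : ∀ {a} {A : Set a} → Dec A → ℕ
𝟙 (yes _) = 1
𝟙 (no _)  = 0

𝟙-yes : ∀ {a} {A : Set a} (d : Dec A) → A → 𝟙 d ≡ 1
𝟙-yes (yes _) _ = refl
𝟙-yes (no ¬a) a = contradiction a ¬a

𝟙-no : ∀ {a} {A : Set a} (d : Dec A) → ¬ A → 𝟙 d ≡ 0
𝟙-no (yes a) ¬a = contradiction a ¬a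
𝟙-no (no _)  _  = refl

𝟙-cong : ∀ {a b} {A : Set a} {B : Set b} (x : Dec A) (y : Dec B) → (A → B) → (B → A) → 𝟙 x ≡ 𝟙 y
𝟙-cong (yes a) y       to _    = sym (𝟙-yes y (to a))
𝟙-cong (no ¬a) (yes b) _  from = contradiction (from b) ¬a
𝟙-cong (no _)  (no _)  _  _    = refl

sum-filter : ∀ {p} {P : Pred ℕ p} (P? : Decidable P) f xs →
  sum (map f (filter P? xs)) ≡ sum (map (λ x → 𝟙 (P? x) * f x) xs)
sum-filter P? f []       = refl
sum-filter P? f (x ∷ xs) with P? x
... | yes _ = cong₂ _+_ (sym (+-identityʳ (f x))) (sum-filter P? f xs)
... | no _  = sum-filter P? f xs

length-filter : ∀ {p} {P : Pred ℕ p} (P? : Decidable P) xs →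
  length (filter P? xs) ≡ sum (map (𝟙 ∘ P?) xs)
length-filter P? []       = refl
length-filter P? (x ∷ xs) with P? x
... | yes _ = cong suc (length-filter P? xs)
... | no _  = length-filter P? xs

∑∣ : ℕ → (ℕ → ℕ) → ℕ
∑∣ n f = sum (map f (divisors n))

∑∣-as-∑ : ∀ n f → ∑∣ n f ≡ ∑ n (λ d → 𝟙 (suc d ∣? n) * f (suc d))
∑∣-as-∑ n f = begin
  sum (map f (filter (_∣? n) (map suc (upTo n))))         ≡⟨ sum-filter (_∣? n) f (map suc (upTo n)) ⟩
  sum (map (λ d → 𝟙 (d ∣? n) * f d) (map suc (upTo n)))  ≡⟨ cong sum (sym (map-∘ (upTo n))) ⟩
  sum (map (λ d → 𝟙 (suc d ∣? n) * f (suc d)) (upTo n))   ≡⟨ cong sum (map-upTo _ n) ⟩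
  ∑ n (λ d → 𝟙 (suc d ∣? n) * f (suc d))                  ∎
  where open ≡-Reasoning

totient-as-∑ : ∀ n → totient n ≡ ∑ n (λ k → 𝟙 (coprime? k n))
totient-as-∑ n = trans (length-filter (λ k → coprime? k n) (upTo n)) (cong sum (map-upTo _ n))

totient-pos : ∀ n → .{{NonZero n}} → 0 < totient n
totient-pos 1 = z<s
totient-pos n@(suc (suc _)) rewrite totient-as-∑ n =
  ≤-trans (≤-reflexive (sym (𝟙-yes (coprime? 1 n) (1-coprimeTo n)))) (term≤∑ n (λ k → 𝟙 (coprime? k n)) (s<s z<s))

-- the one divisor counted is n / gcd k n
unique-gcd-cofactor : ∀ n k → .{{NonZero n}} → ∑ n (λ d → 𝟙 (suc d ∣? n) * 𝟙 (gcd k n * suc d ≟ n)) ≡ 1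
unique-gcd-cofactor n k with gcd[m,n]∣n k n
... | divides zero n≡0 = contradiction n≡0 (ℕ.≢-nonZero⁻¹ n)
... | divides (suc e) n≡e*g =
  trans (∑-single n f e others (λ n≤e → contradiction n≤e (<⇒≱ (∣⇒≤ e+1∣n)))) fe≡1
  where
  g : ℕ
  g = gcd k n
  f : ℕ → ℕ
  f d = 𝟙 (suc d ∣? n) * 𝟙 (g * suc d ≟ n)
  g*e+1≡n : g * suc e ≡ n
  g*e+1≡n = trans (*-comm g (suc e)) (sym n≡e*g)
  e+1∣n : suc e ∣ n
  e+1∣n = divides g (sym g*e+1≡n)
  instance
    g≢0 : NonZero g
    g≢0 = ℕ.≢-nonZero λ g≡0 → ℕ.≢-nonZero⁻¹ n (trans n≡e*g (trans (cong (suc e *_) g≡0) (*-zeroʳ (suc e))))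
  fe≡1 : f e ≡ 1
  fe≡1 rewrite 𝟙-yes (suc e ∣? n) e+1∣n | 𝟙-yes (g * suc e ≟ n) g*e+1≡n = refl
  others : ∀ {d} → d < n → d ≢ e → f d ≡ 0
  others {d} _ d≢e = trans (cong (𝟙 (suc d ∣? n) *_) (𝟙-no (g * suc d ≟ n) (d≢e ∘ suc-injective ∘ *-cancelˡ-≡ (suc d) (suc e) g ∘ flip trans (sym g*e+1≡n))))
    (*-zeroʳ (𝟙 (suc d ∣? n)))

gcd-*ʳ : ∀ j D q → gcd (j * q) (D * q) ≡ q * gcd j D
gcd-*ʳ j D q = trans (cong₂ gcd (*-comm j q) (*-comm D q)) (sym (c*gcd[m,n]≡gcd[cm,cn] q j D))

-- the k < D * q with gcd k (D * q) = q are the j * q with j coprime to D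
count-gcd≡totient : ∀ D q → .{{NonZero D}} → .{{NonZero q}} →
  ∑ (D * q) (λ k → 𝟙 (gcd k (D * q) * D ≟ D * q)) ≡ totient D
count-gcd≡totient D q = begin
  ∑ (D * q) (λ k → 𝟙 (gcd k (D * q) * D ≟ D * q))  ≡⟨ ∑-multiples D q _ off-multiples ⟩
  ∑ D (λ j → 𝟙 (gcd (j * q) (D * q) * D ≟ D * q))   ≡⟨ ∑-cong D (λ {j} _ → 𝟙-cong _ (coprime? j D) (to j) (from j)) ⟩
  ∑ D (λ j → 𝟙 (coprime? j D))                      ≡⟨ totient-as-∑ D ⟨
  totient D                                         ∎
  where
  open ≡-Reasoning
  off-multiples : ∀ {k} → ¬ q ∣ k → 𝟙 (gcd k (D * q) * D ≟ D * q) ≡ 0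
  off-multiples {k} q∤k = 𝟙-no _ λ g*D≡D*q →
    q∤k (subst (_∣ k) (*-cancelʳ-≡ _ q D (trans g*D≡D*q (*-comm D q))) (gcd[m,n]∣m k (D * q)))
  to : ∀ j → gcd (j * q) (D * q) * D ≡ D * q → Coprime j D
  to j g*D≡D*q = gcd≡1⇒coprime (*-cancelˡ-≡ (gcd j D) 1 q (*-cancelʳ-≡ _ _ D (begin
    q * gcd j D * D          ≡⟨ cong (_* D) (gcd-*ʳ j D q) ⟨
    gcd (j * q) (D * q) * D  ≡⟨ g*D≡D*q ⟩
    D * q                    ≡⟨ *-comm D q ⟩
    q * D                    ≡⟨ cong (_* D) (*-identityʳ q) ⟨
    q * 1 * D                ∎)))
  from : ∀ j → Coprime j D → gcd (j * q) (D * q) * D ≡ D * q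
  from j j⊥D = begin
    gcd (j * q) (D * q) * D  ≡⟨ cong (_* D) (gcd-*ʳ j D q) ⟩
    q * gcd j D * D          ≡⟨ cong (λ x → q * x * D) (coprime⇒gcd≡1 j⊥D) ⟩
    q * 1 * D                ≡⟨ cong (_* D) (*-identityʳ q) ⟩
    q * D                    ≡⟨ *-comm q D ⟩
    D * q                    ∎

∑∣-totient : ∀ n → .{{NonZero n}} → ∑∣ n totient ≡ n
∑∣-totient n = sym $ begin
  n                                                                      ≡⟨ ∑-const-1 n ⟨
  ∑ n (λ _ → 1)                                                          ≡⟨ ∑-cong n (λ {k} _ → unique-gcd-cofactor n k) ⟨
  ∑ n (λ k → ∑ n (λ d → 𝟙 (suc d ∣? n) * 𝟙 (gcd k n * suc d ≟ n)))      ≡⟨ ∑-comm n n _ ⟩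
  ∑ n (λ d → ∑ n (λ k → 𝟙 (suc d ∣? n) * 𝟙 (gcd k n * suc d ≟ n)))      ≡⟨ ∑-cong n (λ {d} _ → ∑-*ˡ n (𝟙 (suc d ∣? n)) _) ⟩
  ∑ n (λ d → 𝟙 (suc d ∣? n) * ∑ n (λ k → 𝟙 (gcd k n * suc d ≟ n)))      ≡⟨ ∑-cong n (λ {d} _ → divisor-term d) ⟩
  ∑ n (λ d → 𝟙 (suc d ∣? n) * totient (suc d))                           ≡⟨ ∑∣-as-∑ n totient ⟨
  ∑∣ n totient                                                           ∎
  where
  open ≡-Reasoning
  divisor-term : ∀ d → 𝟙 (suc d ∣? n) * ∑ n (λ k → 𝟙 (gcd k n * suc d ≟ n)) ≡ 𝟙 (suc d ∣? n) * totient (suc d)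
  divisor-term d with suc d ∣? n
  ... | no _ = refl
  ... | yes (divides zero n≡0) = contradiction n≡0 (ℕ.≢-nonZero⁻¹ n)
  ... | yes (divides q@(suc _) n≡q*D) = cong (1 *_)
    (subst (λ N → ∑ N (λ k → 𝟙 (gcd k N * suc d ≟ N)) ≡ totient (suc d))
           (trans (*-comm (suc d) q) (sym n≡q*D)) (count-gcd≡totient (suc d) q))

totient-unique : ∀ (D : ℕ → ℕ) → (∀ n → .{{NonZero n}} → ∑∣ n D ≡ n) → ∀ n → .{{NonZero n}} → D n ≡ totient n
totient-unique D ∑∣D≡id (suc n) = <-rec (λ k → D (suc k) ≡ totient (suc k)) step n
  where
  step : ∀ n → (∀ {m} → m < n → D (suc m) ≡ totient (suc m)) → D (suc n) ≡ totient (suc n)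
  step n ih = *-cancelˡ-≡ _ _ 1 (subst (λ c → c * D (suc n) ≡ c * totient (suc n)) (𝟙-yes (suc n ∣? suc n) ∣-refl) top)
    where
    f g : ℕ → ℕ
    f d = 𝟙 (suc d ∣? suc n) * D (suc d)
    g d = 𝟙 (suc d ∣? suc n) * totient (suc d)
    ∑f≡∑g : ∑ (suc n) f ≡ ∑ (suc n) g
    ∑f≡∑g = begin
      ∑ (suc n) f        ≡⟨ ∑∣-as-∑ (suc n) D ⟨
      ∑∣ (suc n) D       ≡⟨ ∑∣D≡id (suc n) ⟩
      suc n              ≡⟨ ∑∣-totient (suc n) ⟨
      ∑∣ (suc n) totient ≡⟨ ∑∣-as-∑ (suc n) totient ⟩
      ∑ (suc n) g        ∎
      where open ≡-Reasoning
    top : f n ≡ g n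
    top = ∑-cancel (suc n) f g ∑f≡∑g (λ {d} d<1+n d≢n → cong (𝟙 (suc d ∣? suc n) *_) (ih (≤∧≢⇒< (≤-pred d<1+n) d≢n))) ≤-refl

∑∣-degree-cyclotomic : ∀ {Φ} → IsCyclotomicFamily Φ → ∀ n → .{{NonZero n}} → ∑∣ n (degree ∘ Φ) ≡ n
∑∣-degree-cyclotomic {Φ} cyclotomic n@(suc _) = begin
  ∑∣ n (degree ∘ Φ)                      ≡⟨ cong sum (map-∘ (divisors n)) ⟩
  sum (map degree (map Φ (divisors n)))  ≡⟨ HasDegree-unique (HasDegree-prodₚ (map Φ (divisors n)) ∏≉0) ∏-deg ⟩
  n                                      ∎
  where
  open ≡-Reasoning
  ∏-deg : prodₚ (map Φ (divisors n)) HasDegree n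
  ∏-deg = HasDegree-resp-≈ₚ (cyclotomic n _) (HasDegree-xPowMinusOne n)
  ∏≉0 : ¬ prodₚ (map Φ (divisors n)) ≈ₚ []
  ∏≉0 ∏≈0 = leading≢0 ∏-deg (∏≈0 n)

degree-cyclotomic : ∀ {Φ} → IsCyclotomicFamily Φ → ∀ n → .{{NonZero n}} → degree (Φ n) ≡ totient n
degree-cyclotomic {Φ} cyclotomic = totient-unique (degree ∘ Φ) (∑∣-degree-cyclotomic cyclotomic)

vanishes-above-cofactor : ∀ f g {m} → f *ₚ g HasDegree m → 0 < degree g → ∀ {n} → m ≤ n → coeff f n ≡ + 0
vanishes-above-cofactor f g {m} fg-m@(mkHasDegree fg≢0 _) deg-g>0 {n} m≤n with zero⊎HasDegree f
... | inj₁ f≈0 = f≈0 n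
... | inj₂ (d , f-d@(mkHasDegree _ above-d)) = above-d (≤-trans d<m m≤n)
  where
  g≉0 : ¬ g ≈ₚ []
  g≉0 g≈0 = fg≢0 (*ₚ-zero f g g≈0 m)
  d+deg-g≡m : d + degree g ≡ m
  d+deg-g≡m = HasDegree-unique (HasDegree-*ₚ f g f-d (HasDegree-degree g g≉0)) fg-m
  d<m : d < m
  d<m = subst (d <_) d+deg-g≡m (subst (_≤ d + degree g) (+-comm d 1) (+-monoʳ-≤ d deg-g>0))

IsPsi-vanishes-above : ∀ {Φ} → IsCyclotomicFamily Φ → ∀ m → .{{NonZero m}} → ∀ Ψ → IsPsi Φ m Ψ →
  ∀ {n} → m ≤ n → coeff Ψ n ≡ + 0
IsPsi-vanishes-above {Φ} cyclotomic m Ψ Ψ*Φₘ≈xᵐ-1 = vanishes-above-cofactor Ψ (Φ m)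
  (HasDegree-resp-≈ₚ (sym ∘ Ψ*Φₘ≈xᵐ-1) (HasDegree-xPowMinusOne m))
  (subst (0 <_) (sym (degree-cyclotomic cyclotomic m)) (totient-pos m))

module _ (m : ℕ) .{{_ : NonZero m}} where

  [k%m+n]%m≡[k+n]%m : ∀ k n → (k % m + n) % m ≡ (k + n) % m
  [k%m+n]%m≡[k+n]%m k n = begin
    (k % m + n) % m          ≡⟨ %-distribˡ-+ (k % m) n m ⟩
    (k % m % m + n % m) % m  ≡⟨ cong (λ x → (x + n % m) % m) (m%n%n≡m%n k m) ⟩
    (k % m + n % m) % m      ≡⟨ %-distribˡ-+ k n m ⟨
    (k + n) % m              ∎
    where open ≡-Reasoning

  [a+m*j+k]%m≡[a+k]%m : ∀ a j k → (a + m * j + k) % m ≡ (a + k) % m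
  [a+m*j+k]%m≡[a+k]%m a j k = trans
    (cong (_% m) (solve 4 (λ a m j k → a :+ m :* j :+ k := a :+ k :+ j :* m) refl a m j k))
    ([m+kn]%n≡m%n (a + k) j m)

  [k+i*p]%m≡[k+i*[p%m]]%m : ∀ k i p → (k + i * p) % m ≡ (k + i * (p % m)) % m
  [k+i*p]%m≡[k+i*[p%m]]%m k i p = begin
    (k + i * p) % m                                   ≡⟨ cong (λ x → (k + i * x) % m) (m≡m%n+[m/n]*n p m) ⟩
    (k + i * (p % m + p / m * m)) % m                 ≡⟨ cong (_% m) (solve 5 (λ k i r t m → k :+ i :* (r :+ t :* m) := k :+ i :* r :+ i :* t :* m) refl k i (p % m) (p / m) m) ⟩
    (k + i * (p % m) + i * (p / m) * m) % m           ≡⟨ [m+kn]%n≡m%n (k + i * (p % m)) (i * (p / m)) m ⟩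
    (k + i * (p % m)) % m                             ∎
    where open ≡-Reasoning

  [m∸s%m+x+s]%m≡x%m : ∀ s x → (m ∸ s % m + x + s) % m ≡ x % m
  [m∸s%m+x+s]%m≡x%m s x = begin
    (m ∸ σ + x + s) % m                   ≡⟨ cong (λ y → (m ∸ σ + x + y) % m) (m≡m%n+[m/n]*n s m) ⟩
    (m ∸ σ + x + (σ + s / m * m)) % m     ≡⟨ cong (_% m) (solve 4 (λ a x σ t → a :+ x :+ (σ :+ t) := x :+ (a :+ σ) :+ t) refl (m ∸ σ) x σ (s / m * m)) ⟩
    (x + (m ∸ σ + σ) + s / m * m) % m     ≡⟨ cong (λ y → (x + y + s / m * m) % m) (m∸n+n≡m (m%n≤n s m)) ⟩
    (x + m + s / m * m) % m               ≡⟨ [m+kn]%n≡m%n (x + m) (s / m) m ⟩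
    (x + m) % m                           ≡⟨ [m+n]%n≡m%n x m ⟩
    x % m                                 ∎
    where
    open ≡-Reasoning
    σ : ℕ
    σ = s % m

  [m∸s%m+[k+s]%m]%m≡k : ∀ s {k} → k < m → (m ∸ s % m + (k + s) % m) % m ≡ k
  [m∸s%m+[k+s]%m]%m≡k s {k} k<m = begin
    (m ∸ s % m + (k + s) % m) % m  ≡⟨ cong (_% m) (+-comm (m ∸ s % m) _) ⟩
    ((k + s) % m + (m ∸ s % m)) % m ≡⟨ [k%m+n]%m≡[k+n]%m (k + s) (m ∸ s % m) ⟩
    (k + s + (m ∸ s % m)) % m      ≡⟨ cong (_% m) (solve 3 (λ k s a → k :+ s :+ a := a :+ k :+ s) refl k s (m ∸ s % m)) ⟩
    (m ∸ s % m + k + s) % m        ≡⟨ [m∸s%m+x+s]%m≡x%m s k ⟩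
    k % m                          ≡⟨ m<n⇒m%n≡m k<m ⟩
    k                              ∎
    where open ≡-Reasoning

  [m∸s%m+u]%m≡k⇒u≡[k+s]%m : ∀ s {u k} → u < m → (m ∸ s % m + u) % m ≡ k → u ≡ (k + s) % m
  [m∸s%m+u]%m≡k⇒u≡[k+s]%m s {u} {k} u<m [m∸s%m+u]%m≡k = begin
    u                              ≡⟨ m<n⇒m%n≡m u<m ⟨
    u % m                          ≡⟨ [m∸s%m+x+s]%m≡x%m s u ⟨
    (m ∸ s % m + u + s) % m        ≡⟨ [k%m+n]%m≡[k+n]%m (m ∸ s % m + u) s ⟨
    ((m ∸ s % m + u) % m + s) % m  ≡⟨ cong (λ y → (y + s) % m) [m∸s%m+u]%m≡k ⟩
    (k + s) % m                    ∎
    where open ≡-Reasoning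

  module _ (f : Poly) (f-vanishes : ∀ {n} → m ≤ n → coeff f n ≡ + 0) where

    eCoeff≡coeff-% : ∀ t → eCoeff m f t ≡ coeff f (t % m)
    eCoeff≡coeff-% t = begin
      eCoeff m f t          ≡⟨ cong sumℤ (map-upTo h (suc t)) ⟩
      ℤSum.∑ (suc t) h      ≡⟨ ℤSum.∑-single (suc t) h (t % m) others (λ t<t%m → contradiction (m%n≤m t m) (<⇒≱ t<t%m)) ⟩
      h (t % m)             ≡⟨ at-t%m ⟩
      coeff f (t % m)       ∎
      where
      open ≡-Reasoning
      h : ℕ → ℤ
      h k = coeff f k ℤ.* indicator (m ∣? (t ∸ k))
      m∣t∸t%m : m ∣ t ∸ t % m
      m∣t∸t%m = divides (t / m) (trans (cong (_∸ t % m) (m≡m%n+[m/n]*n t m)) (m+n∸m≡n (t % m) _))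
      at-t%m : h (t % m) ≡ coeff f (t % m)
      at-t%m with m ∣? (t ∸ t % m)
      ... | yes _     = ℤ.*-identityʳ _
      ... | no m∤t∸t%m = contradiction m∣t∸t%m m∤t∸t%m
      others : ∀ {k} → k < suc t → k ≢ t % m → h k ≡ + 0
      others {k} (s≤s k≤t) k≢t%m with m ≤? k
      ... | yes m≤k = trans (cong (ℤ._* _) (f-vanishes m≤k)) (ℤ.*-zeroˡ (indicator (m ∣? (t ∸ k))))
      ... | no m≰k with m ∣? (t ∸ k)
      ...   | no _      = ℤ.*-zeroʳ (coeff f k)
      ...   | yes m∣t∸k = contradiction (begin
              k               ≡⟨ m<n⇒m%n≡m (≰⇒> m≰k) ⟨
              k % m           ≡⟨ %-remove-+ˡ k m∣t∸k ⟨
              (t ∸ k + k) % m ≡⟨ cong (_% m) (m∸n+n≡m k≤t) ⟩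
              t % m           ∎) k≢t%m

    Rop-rotates : ∀ s → Rop m s f ≡ applyUpTo (λ k → coeff f ((k + s) % m)) m
    Rop-rotates s = trans (map-upTo _ m) (applyUpTo-cong m coefficient)
      where
      s′ : ℕ
      s′ = m ∸ s % m
      g : Poly
      g = shiftₚ s′ f
      H : ℕ → ℕ → ℤ
      H k t = indicator ((t % m) ℕ.≟ k) ℤ.* coeff g t
      -- within the support [s′, s′ + m) of g the residue class of k consists of s′ + (k + s) % m alone
      off-target-shifted : ∀ {k} u → (s′ + u) % m ≡ k → s′ + u ≢ s′ + (k + s) % m → coeff f u ≡ + 0
      off-target-shifted u [s′+u]%m≡k s′+u≢t₀ with m ≤? u
      ... | yes m≤u = f-vanishes m≤u
      ... | no m≰u  = contradiction (cong (_+_ s′) ([m∸s%m+u]%m≡k⇒u≡[k+s]%m s (≰⇒> m≰u) [s′+u]%m≡k)) s′+u≢t₀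
      off-target : ∀ {k t} → t % m ≡ k → t ≢ s′ + (k + s) % m → coeff g t ≡ + 0
      off-target {k} {t} t%m≡k t≢t₀ with t <? s′
      ... | yes t<s′ = coeff-shiftₚ-< s′ f t<s′
      ... | no t≮s′  = begin
        coeff g t          ≡⟨ cong (coeff g) s′+u≡t ⟨
        coeff g (s′ + u)   ≡⟨ coeff-shiftₚ s′ f u ⟩
        coeff f u          ≡⟨ off-target-shifted u (trans (cong (_% m) s′+u≡t) t%m≡k) (t≢t₀ ∘ trans (sym s′+u≡t)) ⟩
        + 0                ∎
        where
        open ≡-Reasoning
        u : ℕ
        u = t ∸ s′
        s′+u≡t : s′ + u ≡ t
        s′+u≡t = m+[n∸m]≡n (≮⇒≥ t≮s′)
      coefficient : ∀ {k} → k < m → sumℤ (map (H k) (upTo (length g))) ≡ coeff f ((k + s) % m)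
      coefficient {k} k<m = begin
        sumℤ (map (H k) (upTo (length g)))  ≡⟨ cong sumℤ (map-upTo (H k) (length g)) ⟩
        ℤSum.∑ (length g) (H k)             ≡⟨ ℤSum.∑-single (length g) (H k) t₀ others outside ⟩
        H k t₀                              ≡⟨ at-t₀ ⟩
        coeff f ((k + s) % m)               ∎
        where
        open ≡-Reasoning
        t₀ : ℕ
        t₀ = s′ + (k + s) % m
        at-t₀ : H k t₀ ≡ coeff f ((k + s) % m)
        at-t₀ with (t₀ % m) ℕ.≟ k
        ... | yes _     = trans (ℤ.*-identityˡ _) (coeff-shiftₚ s′ f ((k + s) % m))
        ... | no t₀≢k   = contradiction ([m∸s%m+[k+s]%m]%m≡k s k<m) t₀≢k
        outside : length g ≤ t₀ → H k t₀ ≡ + 0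
        outside beyond = trans (cong (ℤ._*_ (indicator ((t₀ % m) ℕ.≟ k))) (coeff-beyond g beyond))
          (ℤ.*-zeroʳ (indicator ((t₀ % m) ℕ.≟ k)))
        others : ∀ {t} → t < length g → t ≢ t₀ → H k t ≡ + 0
        others {t} _ t≢t₀ with (t % m) ℕ.≟ k
        ... | no _      = ℤ.*-zeroˡ (coeff g t)
        ... | yes t%m≡k = trans (ℤ.*-identityˡ _) (off-target t%m≡k t≢t₀)

module _ (m : ℕ) (Ψ : Poly) (p i q r : ℕ) where

  gPoly-< : ∀ {j} → j < q → gPoly m Ψ p i j q r ≡ applyUpTo (λ k → eCoeff m Ψ (i * p + m * j + k)) m
  gPoly-< {j} j<q with j <? q
  ... | yes _   = map-upTo _ m
  ... | no j≮q = contradiction j<q j≮q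

  gPoly-last : gPoly m Ψ p i q q r ≡ applyUpTo (λ k → eCoeff m Ψ (i * p + m * q + k)) r
  gPoly-last with q <? q
  ... | yes q<q = contradiction q<q (<-irrefl refl)
  ... | no _    = map-upTo _ r

  take-gPoly : ∀ j → r ≤ m → take r (gPoly m Ψ p i j q r) ≡ applyUpTo (λ k → eCoeff m Ψ (i * p + m * j + k)) r
  take-gPoly j r≤m with j <? q
  ... | yes _ = trans (cong (take r) (map-upTo _ m)) (take-applyUpTo _ r≤m)
  ... | no _  = trans (cong (take r) (map-upTo _ r)) (take-applyUpTo _ ≤-refl)

  module _ .{{_ : NonZero m}} (Ψ-vanishes : ∀ {n} → m ≤ n → coeff Ψ n ≡ + 0) where

    gPoly-rotation : ∀ {j} → j < q → gPoly m Ψ p i j q r ≡ Rop m (i * (p % m)) Ψ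
    gPoly-rotation {j} j<q = begin
      gPoly m Ψ p i j q r                                 ≡⟨ gPoly-< j<q ⟩
      applyUpTo (λ k → eCoeff m Ψ (i * p + m * j + k)) m  ≡⟨ applyUpTo-cong m (λ {k} _ → trans (eCoeff≡coeff-% m Ψ Ψ-vanishes _) (cong (coeff Ψ) (index k))) ⟩
      applyUpTo (λ k → coeff Ψ ((k + i * (p % m)) % m)) m ≡⟨ Rop-rotates m Ψ Ψ-vanishes (i * (p % m)) ⟨
      Rop m (i * (p % m)) Ψ                               ∎
      where
      open ≡-Reasoning
      index : ∀ k → (i * p + m * j + k) % m ≡ (k + i * (p % m)) % m
      index k = begin
        (i * p + m * j + k) % m  ≡⟨ [a+m*j+k]%m≡[a+k]%m m (i * p) j k ⟩
        (i * p + k) % m          ≡⟨ cong (_% m) (+-comm (i * p) k) ⟩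
        (k + i * p) % m          ≡⟨ [k+i*p]%m≡[k+i*[p%m]]%m m k i p ⟩
        (k + i * (p % m)) % m    ∎

    gPoly-truncation : r ≤ m → gPoly m Ψ p i q q r ≡ take r (gPoly m Ψ p i 0 q r)
    gPoly-truncation r≤m = begin
      gPoly m Ψ p i q q r                                 ≡⟨ gPoly-last ⟩
      applyUpTo (λ k → eCoeff m Ψ (i * p + m * q + k)) r  ≡⟨ applyUpTo-cong r (λ {k} _ → same-residue k) ⟩
      applyUpTo (λ k → eCoeff m Ψ (i * p + m * 0 + k)) r  ≡⟨ take-gPoly 0 r≤m ⟨
      take r (gPoly m Ψ p i 0 q r)                        ∎
      where
      open ≡-Reasoning
      e≡Ψ : ∀ t → eCoeff m Ψ t ≡ coeff Ψ (t % m)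
      e≡Ψ = eCoeff≡coeff-% m Ψ Ψ-vanishes
      same-residue : ∀ k → eCoeff m Ψ (i * p + m * q + k) ≡ eCoeff m Ψ (i * p + m * 0 + k)
      same-residue k = begin
        eCoeff m Ψ (i * p + m * q + k)     ≡⟨ e≡Ψ _ ⟩
        coeff Ψ ((i * p + m * q + k) % m)  ≡⟨ cong (coeff Ψ) ([a+m*j+k]%m≡[a+k]%m m (i * p) q k) ⟩
        coeff Ψ ((i * p + k) % m)          ≡⟨ cong (coeff Ψ) ([a+m*j+k]%m≡[a+k]%m m (i * p) 0 k) ⟨
        coeff Ψ ((i * p + m * 0 + k) % m)  ≡⟨ e≡Ψ _ ⟨
        eCoeff m Ψ (i * p + m * 0 + k)     ∎

mainTheorem6 : (Φ : ℕ → Poly) → IsCyclotomicFamily Φ →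
    (m : ℕ) → .{{_ : NonZero m}} → ¬ (2 ∣ m) → (∀ d → d * d ∣ m → d ≡ 1) →
    (p : ℕ) → Prime p → Coprime p m →
    (Ψ : Poly) → IsPsi Φ m Ψ →
    ∀ i → i < totient m →
      (∀ j → j < p / m → gPoly m Ψ p i j (p / m) (p % m) ≈ₚ Rop m (i * (p % m)) Ψ)
      × (gPoly m Ψ p i (p / m) (p / m) (p % m) ≈ₚ Top (p % m) (gPoly m Ψ p i 0 (p / m) (p % m)))
mainTheorem6 Φ cyclotomic m _ _ p _ _ Ψ Ψ*Φₘ≈xᵐ-1 i _ =
  (λ j j<q → ≡⇒≈ₚ (gPoly-rotation m Ψ p i (p / m) (p % m) Ψ-vanishes j<q)) ,
  ≡⇒≈ₚ (gPoly-truncation m Ψ p i (p / m) (p % m) Ψ-vanishes (<⇒≤ (m%n<n p m)))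
  where
  Ψ-vanishes : ∀ {n} → m ≤ n → coeff Ψ n ≡ + 0
  Ψ-vanishes = IsPsi-vanishes-above cyclotomic m Ψ Ψ*Φₘ≈xᵐ-1
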